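{- Let $1\le\ell\le k-1$ be integers such that $k-\ell$ does not divide $k$, and let $m\ge\lceil k/(k-\ell)\rceil$ be an integer. Then the $k$-uniform $\ell$-cycle $C$ with $k^2\ell+m$ edges is $k$-partite. Moreover, if $m=\lceil k/(k-\ell)\rceil$, then $\gcd(C)=1$.
   Context: A $k$-graph has a vertex set and $k$-element edges. An $\ell$-cycle is a $k$-graph with cyclically ordered vertices, every edge consisting of $k$ consecutive vertices and consecutive edges meeting in exactly $\ell$ vertices. A proper $t$-colouring of a $k$-graph $F$ assigns to each vertex one of $t$ colours $1,\dots,t$ so that no edge contains two vertices of the same colour; $\chi(F)$ is the least $t$ admitting a proper $t$-colouring, and $F$ is $k$-partite if it has a proper $k$-colouring. $\mathcal D(F)$ is the set of integers $\big||\phi^{ -1}(1)|-|\phi^{ -1}(2)|\big|$ over all proper $\chi(F)$-colourings $\phi$ of $F$, and $\gcd(F)$ is the greatest common divisor of $\mathcal D(F)\setminus\{0\}$, with $\gcd(F)=\infty$ if $\mathcal D(F)=\{0\}$. -}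

module Defs where

open import Data.Nat using (ℕ; zero; suc; _+_; _*_; _∸_; _≤_; _<_; _/_; _%_; ∣_-_∣; _≟_)
open import Data.Nat.Divisibility using (_∣_)
open import Data.Fin using (Fin; toℕ)
open import Data.List using (List; length; filter)
open import Data.List.Base using (allFin)
open import Data.Product using (Σ; ∃; _×_)
open import Relation.Nullary using (¬_)
open import Relation.Binary.PropositionalEquality using (_≡_; _≢_)

ceilDiv : ℕ → ℕ → ℕ
ceilDiv a zero    = 0
ceilDiv a (suc d) = (a + d) / suc d

modℕ : ℕ → ℕ → ℕ
modℕ a zero    = a
modℕ a (suc n) = a % suc n

-- A k-graph: nV vertices (Fin nV), nE edges indexed by i < nE,
-- InEdge i v  means vertex v belongs to edge i.
record Hypergraph : Set₁ where
  field
    nV     : ℕ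
    nE     : ℕ
    InEdge : ℕ → Fin nV → Set
open Hypergraph public

cycle : (k ℓ e : ℕ) → Hypergraph
cycle k ℓ e = record
  { nV = e * (k ∸ ℓ)
  ; nE = e
  ; InEdge = λ i v → Σ ℕ λ j → j < k × toℕ v ≡ modℕ (i * (k ∸ ℓ) + j) (e * (k ∸ ℓ))
  }

ProperColouring : (H : Hypergraph) → ℕ → (Fin (nV H) → ℕ) → Set
ProperColouring H t φ =
  (∀ v → 1 ≤ φ v × φ v ≤ t) ×
  (∀ i → i < nE H → ∀ u v → u ≢ v → InEdge H i u → InEdge H i v → φ u ≢ φ v)

Colourable : Hypergraph → ℕ → Set
Colourable H t = ∃ λ φ → ProperColouring H t φ

Partite : ℕ → Hypergraph → Set
Partite k H = Colourable H k

IsChromaticNumber : Hypergraph → ℕ → Set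
IsChromaticNumber H t = Colourable H t × (∀ s → s < t → ¬ Colourable H s)

classSize : (H : Hypergraph) → (Fin (nV H) → ℕ) → ℕ → ℕ
classSize H φ c = length (filter (λ v → φ v ≟ c) (allFin (nV H)))

InD : Hypergraph → ℕ → Set
InD H x = ∃ λ t → IsChromaticNumber H t ×
  ∃ λ φ → ProperColouring H t φ × x ≡ ∣ classSize H φ 1 - classSize H φ 2 ∣

-- gcd(H) = g : g is the greatest common divisor of 𝒟(H) ∖ {0}
-- (for g finite; if 𝒟(H) ∖ {0} is empty no finite g satisfies this except
--  one divisible by everything, i.e. none with g = 1)
IsGcdD : Hypergraph → ℕ → Set
IsGcdD H g =
  (∀ x → InD H x → x ≢ 0 → g ∣ x) ×
  (∀ d → (∀ x → InD H x → x ≢ 0 → d ∣ x) → d ∣ g)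

{-# OPTIONS --safe #-}
-- Write d = k ∸ ℓ and k = q d + r; as d ∤ k, 0 < r < d.  List the e d vertices of the cycle in
-- order, so that an edge is a window of k consecutive vertices starting at a multiple of d.
-- Split the vertices into two kinds and colour a vertex of the first kind by the number of
-- earlier ones modulo j₀, and one of the second kind likewise modulo j₁, where j₀ + j₁ = k
-- (with disjoint colour sets).  Every window containing exactly j₀ vertices of the first kind
-- is then rainbow, and the colouring closes up around the cycle when the two totals are
-- multiples of j₀ and j₁.  Such a split exists as soon as the total P of the first kind has
-- q P ≲ j₀ e ≲ (q + 1) P: put ⌊(b + 1) P / e⌋ − ⌊b P / e⌋ of them into the b-th block of d
-- vertices.  For e = k²ℓ + m, j₀ = 1 gives a proper k-colouring.  For m = q + 1 = ⌈k / d⌉,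
-- j₀ = d − r, j₁ = ℓ + r and P = (kℓd + 2) j₀ give colour classes 1 and 2 of sizes kℓd + 2 and
-- kℓd + 1; since an edge has k vertices, χ = k, so 1 ∈ 𝒟(C) and gcd(C) = 1.

module Submission where

open import Defs
open import Data.Nat
  using (ℕ; zero; suc; pred; _+_; _*_; _∸_; _≤_; _<_; _≤′_; _/_; _%_; _⊓_; _≟_; _≡ᵇ_; ∣_-_∣
        ; NonZero; z≤n; s≤s; ≤′-reflexive; ≤′-step; ≢-nonZero; >-nonZero; >-nonZero⁻¹)
open import Data.Nat.Properties
open import Data.Nat.DivMod
open import Data.Nat.Divisibility using (_∣_; divides; divides-refl; ∣⇒≤; 1∣_; m%n≡0⇒n∣m)
open import Data.Bool using (Bool; true; false)
open import Data.Product using (_×_; _,_; ∃; proj₁)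
open import Data.Sum using (_⊎_; inj₁; inj₂)
open import Relation.Nullary using (¬_; yes; no; contradiction)
open import Relation.Binary.PropositionalEquality
open import Data.Nat.Tactic.RingSolver using (solve-∀)
open import Function using (_∘_; id)
open import Data.Fin as Fin using (Fin; toℕ; fromℕ<)
open import Data.Fin.Properties using (toℕ-injective; toℕ-fromℕ<; toℕ<n; pigeonhole)
open import Data.List using (length; filter; tabulate)
open import Relation.Binary.Definitions using (tri<; tri≈; tri>)

[m+kn]/n≡m/n+k : ∀ m k n .{{_ : NonZero n}} → (m + k * n) / n ≡ m / n + k
[m+kn]/n≡m/n+k m k n = trans (+-distrib-/-∣ʳ m (divides-refl k)) (cong (m / n +_) (m*n/n≡m k n))

m<n<m+o⇒m%o≢n%o : ∀ {m n} o .{{_ : NonZero o}} → m < n → n < m + o → m % o ≢ n % o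
m<n<m+o⇒m%o≢n%o {m} {n} o m<n n<m+o m%o≡n%o = <⇒≱ (m<n+o⇒m∸n<o n m n<m+o) (∣⇒≤ o∣n∸m)
  where
  instance
    n∸m≢0 : NonZero (n ∸ m)
    n∸m≢0 = >-nonZero (m<n⇒0<n∸m m<n)
  o∣n∸m : o ∣ n ∸ m
  o∣n∸m = divides (n / o ∸ m / o) (begin
    n ∸ m                                      ≡⟨ cong₂ _∸_ (m≡m%n+[m/n]*n n o) (m≡m%n+[m/n]*n m o) ⟩
    (n % o + n / o * o) ∸ (m % o + m / o * o)  ≡⟨ cong (λ x → (n % o + n / o * o) ∸ (x + m / o * o)) m%o≡n%o ⟩
    (n % o + n / o * o) ∸ (n % o + m / o * o)  ≡⟨ [m+n]∸[m+o]≡n∸o (n % o) _ _ ⟩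
    n / o * o ∸ m / o * o                      ≡⟨ *-distribʳ-∸ o (n / o) (m / o) ⟨
    (n / o ∸ m / o) * o                        ∎)
    where open ≡-Reasoning

UnitStep : ℕ → ℕ → Set
UnitStep x y = y ≡ x ⊎ y ≡ suc x

UnitSteps : (ℕ → ℕ) → Set
UnitSteps H = ∀ y → UnitStep (H y) (H (suc y))

+-unitStepʳ : ∀ a {x y} → UnitStep x y → UnitStep (a + x) (a + y)
+-unitStepʳ a (inj₁ refl) = inj₁ refl
+-unitStepʳ a (inj₂ refl) = inj₂ (+-suc a _)

+-unitStepˡ : ∀ a {x y} → UnitStep x y → UnitStep (x + a) (y + a)
+-unitStepˡ a (inj₁ refl) = inj₁ refl
+-unitStepˡ a (inj₂ refl) = inj₂ refl

⊓-unitStep : ∀ o a → UnitStep (o ⊓ a) (suc o ⊓ a)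
⊓-unitStep zero    zero    = inj₁ refl
⊓-unitStep zero    (suc a) = inj₂ refl
⊓-unitStep (suc o) zero    = inj₁ refl
⊓-unitStep (suc o) (suc a) with ⊓-unitStep o a
... | inj₁ eq = inj₁ (cong suc eq)
... | inj₂ eq = inj₂ (cong suc eq)

fromBool : Bool → ℕ
fromBool false = 0
fromBool true  = 1

count : (ℕ → Bool) → ℕ → ℕ → ℕ
count p a zero    = 0
count p a (suc L) = fromBool (p a) + count p (suc a) L

count-+ : ∀ p a L₁ L₂ → count p a (L₁ + L₂) ≡ count p a L₁ + count p (a + L₁) L₂
count-+ p a zero    L₂ = cong (λ b → count p b L₂) (sym (+-identityʳ a))
count-+ p a (suc L₁) L₂ = begin
  fromBool (p a) + count p (suc a) (L₁ + L₂)                              ≡⟨ cong (fromBool (p a) +_) (count-+ p (suc a) L₁ L₂) ⟩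
  fromBool (p a) + (count p (suc a) L₁ + count p (suc a + L₁) L₂)         ≡⟨ +-assoc (fromBool (p a)) _ _ ⟨
  count p a (suc L₁) + count p (suc a + L₁) L₂                            ≡⟨ cong (λ b → count p a (suc L₁) + count p b L₂) (+-suc a L₁) ⟨
  count p a (suc L₁) + count p (a + suc L₁) L₂                            ∎
  where open ≡-Reasoning

count-none : ∀ p a L → (∀ i → i < L → p (a + i) ≡ false) → count p a L ≡ 0
count-none p a zero    none = refl
count-none p a (suc L) none =
  cong₂ (λ b n → fromBool b + n)
        (trans (cong p (sym (+-identityʳ a))) (none 0 (s≤s z≤n)))
        (count-none p (suc a) L (λ i i<L → trans (cong p (sym (+-suc a i))) (none (suc i) (s≤s i<L))))

count-shift : ∀ p a L → p (a + L) ≡ p a → count p (suc a) L ≡ count p a L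
count-shift p a L periodic = +-cancelˡ-≡ (fromBool (p a)) _ _ (begin
  count p a (suc L)                       ≡⟨ cong (count p a) (+-comm 1 L) ⟩
  count p a (L + 1)                       ≡⟨ count-+ p a L 1 ⟩
  count p a L + (fromBool (p (a + L)) + 0) ≡⟨ cong (λ b → count p a L + (fromBool b + 0)) periodic ⟩
  count p a L + (fromBool (p a) + 0)      ≡⟨ cong (count p a L +_) (+-identityʳ _) ⟩
  count p a L + fromBool (p a)            ≡⟨ +-comm (count p a L) _ ⟩
  fromBool (p a) + count p a L            ∎)
  where open ≡-Reasoning

divisible? : (c : ℕ) .{{_ : NonZero c}} → ℕ → Bool
divisible? c x = x % c ≡ᵇ 0

count-divisible-period : ∀ c .{{_ : NonZero c}} a → count (divisible? c) a c ≡ 1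
count-divisible-period (suc c-1) zero = cong suc (count-none (divisible? (suc c-1)) 1 c-1 λ i i<c-1 →
  cong (_≡ᵇ 0) (m<n⇒m%n≡m (s≤s i<c-1)))
count-divisible-period c (suc a) =
  trans (count-shift (divisible? c) a c (cong (_≡ᵇ 0) ([m+n]%n≡m%n a c))) (count-divisible-period c a)

count-divisible : ∀ c .{{_ : NonZero c}} a s → count (divisible? c) a (s * c) ≡ s
count-divisible c a zero    = refl
count-divisible c a (suc s) = begin
  count (divisible? c) a (c + s * c)                              ≡⟨ count-+ (divisible? c) a c (s * c) ⟩
  count (divisible? c) a c + count (divisible? c) (a + c) (s * c) ≡⟨ cong₂ _+_ (count-divisible-period c a) (count-divisible c (a + c) s) ⟩
  suc s                                                           ∎
  where open ≡-Reasoning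

module Stepping {H : ℕ → ℕ} (steps : UnitSteps H) where

  step-≤ : ∀ y → H y ≤ H (suc y)
  step-≤ y with steps y
  ... | inj₁ eq = ≤-reflexive (sym eq)
  ... | inj₂ eq = ≤-trans (n≤1+n _) (≤-reflexive (sym eq))

  step-≤-suc : ∀ y → H (suc y) ≤ suc (H y)
  step-≤-suc y with steps y
  ... | inj₁ eq = ≤-trans (≤-reflexive eq) (n≤1+n _)
  ... | inj₂ eq = ≤-reflexive eq

  mono-≤′ : ∀ {x y} → x ≤′ y → H x ≤ H y
  mono-≤′ (≤′-reflexive refl) = ≤-refl
  mono-≤′ (≤′-step x≤′y)      = ≤-trans (mono-≤′ x≤′y) (step-≤ _)

  mono-≤ : ∀ {x y} → x ≤ y → H x ≤ H y
  mono-≤ x≤y = mono-≤′ (≤⇒≤′ x≤y)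

  bounded-growth : ∀ y → H y ≤ H 0 + y
  bounded-growth zero    = ≤-reflexive (sym (+-identityʳ _))
  bounded-growth (suc y) = ≤-trans (step-≤-suc y) (≤-trans (s≤s (bounded-growth y)) (≤-reflexive (sym (+-suc _ y))))

  window-residues-distinct : ∀ c .{{_ : NonZero c}} {w L y₁ y₂} → H (w + L) ≡ H w + c →
    w ≤ y₁ → y₁ < y₂ → y₂ < w + L →
    H (suc y₁) ≡ suc (H y₁) → H (suc y₂) ≡ suc (H y₂) → H y₁ % c ≢ H y₂ % c
  window-residues-distinct c {w} {L} {y₁} {y₂} rise w≤y₁ y₁<y₂ y₂<w+L step₁ step₂ =
    m<n<m+o⇒m%o≢n%o c Hy₁<Hy₂ Hy₂<Hy₁+c
    where
    open ≤-Reasoning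
    Hy₁<Hy₂ : H y₁ < H y₂
    Hy₁<Hy₂ = begin-strict
      H y₁       <⟨ n<1+n _ ⟩
      suc (H y₁) ≡⟨ step₁ ⟨
      H (suc y₁) ≤⟨ mono-≤ y₁<y₂ ⟩
      H y₂       ∎
    Hy₂<Hy₁+c : H y₂ < H y₁ + c
    Hy₂<Hy₁+c = begin-strict
      H y₂       <⟨ n<1+n _ ⟩
      suc (H y₂) ≡⟨ step₂ ⟨
      H (suc y₂) ≤⟨ mono-≤ y₂<w+L ⟩
      H (w + L)  ≡⟨ rise ⟩
      H w + c    ≤⟨ +-monoˡ-≤ c (mono-≤ w≤y₁) ⟩
      H y₁ + c   ∎

  count-along : ∀ (p p′ : ℕ → Bool) →
    (∀ y → H (suc y) ≡ suc (H y) → p y ≡ p′ (H y)) →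
    (∀ y → H (suc y) ≡ H y → p y ≡ false) →
    ∀ a L D → H (a + L) ≡ H a + D → count p a L ≡ count p′ (H a) D
  count-along p p′ on-step off-step a zero D rise =
    sym (cong (count p′ (H a)) (+-cancelˡ-≡ (H a) D 0 (begin
      H a + D ≡⟨ rise ⟨
      H (a + 0) ≡⟨ cong H (+-identityʳ a) ⟩
      H a ≡⟨ +-identityʳ (H a) ⟨
      H a + 0 ∎)))
    where open ≡-Reasoning
  count-along p p′ on-step off-step a (suc L) D rise with steps a | D
  ... | inj₁ stay | E = cong₂ (λ b n → fromBool b + n) (off-step a stay) (begin
      count p (suc a) L            ≡⟨ count-along p p′ on-step off-step (suc a) L E rise′ ⟩
      count p′ (H (suc a)) E       ≡⟨ cong (λ x → count p′ x E) stay ⟩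
      count p′ (H a) E             ∎)
    where
    open ≡-Reasoning
    rise′ : H (suc a + L) ≡ H (suc a) + E
    rise′ = trans (cong H (sym (+-suc a L))) (trans rise (cong (_+ E) (sym stay)))
  ... | inj₂ step | zero = contradiction (begin
      suc (H a)      ≡⟨ step ⟨
      H (suc a)      ≤⟨ mono-≤ (m≤m+n (suc a) L) ⟩
      H (suc a + L)  ≡⟨ cong H (+-suc a L) ⟨
      H (a + suc L)  ≡⟨ rise ⟩
      H a + 0        ≡⟨ +-identityʳ (H a) ⟩
      H a            ∎) 1+n≰n
    where open ≤-Reasoning
  ... | inj₂ step | suc D′ = cong₂ (λ b n → fromBool b + n) (on-step a step) (begin
      count p (suc a) L          ≡⟨ count-along p p′ on-step off-step (suc a) L D′ rise′ ⟩
      count p′ (H (suc a)) D′    ≡⟨ cong (λ x → count p′ x D′) step ⟩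
      count p′ (suc (H a)) D′    ∎)
    where
    open ≡-Reasoning
    rise′ : H (suc a + L) ≡ H (suc a) + D′
    rise′ = begin
      H (suc a + L)  ≡⟨ cong H (+-suc a L) ⟨
      H (a + suc L)  ≡⟨ rise ⟩
      H a + suc D′   ≡⟨ +-suc (H a) D′ ⟩
      suc (H a) + D′ ≡⟨ cong (_+ D′) step ⟨
      H (suc a) + D′ ∎

module TwoCounterColouring {F : ℕ → ℕ} (F-steps : UnitSteps F) (j₀ j₁ : ℕ) .{{_ : NonZero j₀}} .{{_ : NonZero j₁}} where

  private module Fs = Stepping F-steps

  -- the number of y′ < y at which F does not step
  R : ℕ → ℕ
  R y = (F 0 + y) ∸ F y

  F+R : ∀ y → F y + R y ≡ F 0 + y
  F+R y = m+[n∸m]≡n (Fs.bounded-growth y)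

  F+R-suc : ∀ y → F (suc y) + R (suc y) ≡ suc (F y + R y)
  F+R-suc y = trans (F+R (suc y)) (trans (+-suc (F 0) y) (cong suc (sym (F+R y))))

  R-step-on-stay : ∀ y → F (suc y) ≡ F y → R (suc y) ≡ suc (R y)
  R-step-on-stay y stay = +-cancelˡ-≡ (F y) _ _ (begin
    F y + R (suc y)       ≡⟨ cong (_+ R (suc y)) stay ⟨
    F (suc y) + R (suc y) ≡⟨ F+R-suc y ⟩
    suc (F y + R y)       ≡⟨ +-suc (F y) (R y) ⟨
    F y + suc (R y)       ∎)
    where open ≡-Reasoning

  R-stay-on-step : ∀ y → F (suc y) ≡ suc (F y) → R (suc y) ≡ R y
  R-stay-on-step y step = +-cancelˡ-≡ (F y) _ _ (suc-injective (begin
    suc (F y) + R (suc y) ≡⟨ cong (_+ R (suc y)) step ⟨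
    F (suc y) + R (suc y) ≡⟨ F+R-suc y ⟩
    suc (F y + R y)       ∎))
    where open ≡-Reasoning

  stay-of-¬step : ∀ y → F (suc y) ≢ suc (F y) → F (suc y) ≡ F y
  stay-of-¬step y ¬step with F-steps y
  ... | inj₁ stay = stay
  ... | inj₂ step = contradiction step ¬step

  R-steps : UnitSteps R
  R-steps y with F-steps y
  ... | inj₁ stay = inj₂ (R-step-on-stay y stay)
  ... | inj₂ step = inj₁ (R-stay-on-step y step)

  private module Rs = Stepping R-steps

  R-shift : ∀ y {z a b} → F (y + z) ≡ F y + a → z ≡ a + b → R (y + z) ≡ R y + b
  R-shift y {z} {a} {b} F-rise z≡a+b = +-cancelˡ-≡ (F y + a) _ _ (begin
    F y + a + R (y + z)   ≡⟨ cong (_+ R (y + z)) F-rise ⟨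
    F (y + z) + R (y + z) ≡⟨ F+R (y + z) ⟩
    F 0 + (y + z)         ≡⟨ cong (λ x → F 0 + (y + x)) z≡a+b ⟩
    F 0 + (y + (a + b))   ≡⟨ +-assoc (F 0) y (a + b) ⟨
    F 0 + y + (a + b)     ≡⟨ cong (_+ (a + b)) (F+R y) ⟨
    F y + R y + (a + b)   ≡⟨ regroup (F y) (R y) a b ⟩
    F y + a + (R y + b)   ∎)
    where
    open ≡-Reasoning
    regroup : ∀ x r a b → x + r + (a + b) ≡ x + a + (r + b)
    regroup = solve-∀

  -- Colour 1 is residue 0 of the first counter and colour 2 residue 0 of the second.
  colourA : ℕ → ℕ
  colourA zero    = 1
  colourA (suc x) = 2 + j₁ + x

  colourB : ℕ → ℕ
  colourB z = 2 + z

  colourA-injective : ∀ {x x′} → colourA x ≡ colourA x′ → x ≡ x′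
  colourA-injective {zero}  {zero}   _  = refl
  colourA-injective {suc x} {suc x′} eq = cong suc (+-cancelˡ-≡ j₁ x x′ (suc-injective (suc-injective eq)))

  colourA≢colourB : ∀ {x z} → z < j₁ → colourA x ≢ colourB z
  colourA≢colourB {suc x} z<j₁ eq = <⇒≢ (≤-trans z<j₁ (m≤m+n j₁ x)) (sym (suc-injective (suc-injective eq)))

  colourA-≤ : ∀ {x} → x < j₀ → colourA x ≤ j₀ + j₁
  colourA-≤ {zero}  _     = ≤-trans (>-nonZero⁻¹ j₀) (m≤m+n j₀ j₁)
  colourA-≤ {suc x} x<j₀ = begin
    2 + j₁ + x   ≡⟨ cong suc (+-comm (suc j₁) x) ⟩
    suc x + suc j₁ ≡⟨ cong suc (+-suc x j₁) ⟩
    2 + x + j₁   ≤⟨ +-monoˡ-≤ j₁ x<j₀ ⟩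
    j₀ + j₁      ∎
    where open ≤-Reasoning

  colourB-≤ : ∀ {z} → z < j₁ → colourB z ≤ j₀ + j₁
  colourB-≤ {z} z<j₁ = ≤-trans (s≤s z<j₁) (+-monoˡ-≤ j₁ (>-nonZero⁻¹ j₀))

  colour : ℕ → ℕ
  colour y with F (suc y) ≟ suc (F y)
  ... | yes _ = colourA (F y % j₀)
  ... | no  _ = colourB (R y % j₁)

  colour-range : ∀ y → 1 ≤ colour y × colour y ≤ j₀ + j₁
  colour-range y with F (suc y) ≟ suc (F y)
  ... | yes _ = colourA-positive (F y % j₀) , colourA-≤ (m%n<n (F y) j₀)
    where
    colourA-positive : ∀ x → 1 ≤ colourA x
    colourA-positive zero    = s≤s z≤n
    colourA-positive (suc x) = s≤s z≤n
  ... | no  _ = s≤s z≤n , colourB-≤ (m%n<n (R y) j₁)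

  colour-window-injective : ∀ {w y₁ y₂} → F (w + (j₀ + j₁)) ≡ F w + j₀ →
    w ≤ y₁ → y₁ < y₂ → y₂ < w + (j₀ + j₁) → colour y₁ ≢ colour y₂
  colour-window-injective {w} {y₁} {y₂} F-rise w≤y₁ y₁<y₂ y₂<end
    with F (suc y₁) ≟ suc (F y₁) | F (suc y₂) ≟ suc (F y₂)
  ... | yes step₁ | yes step₂ =
    Fs.window-residues-distinct j₀ F-rise w≤y₁ y₁<y₂ y₂<end step₁ step₂ ∘ colourA-injective
  ... | no ¬step₁ | no ¬step₂ =
    Rs.window-residues-distinct j₁ (R-shift w F-rise refl) w≤y₁ y₁<y₂ y₂<end
      (R-step-on-stay y₁ (stay-of-¬step y₁ ¬step₁)) (R-step-on-stay y₂ (stay-of-¬step y₂ ¬step₂))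
      ∘ suc-injective ∘ suc-injective
  ... | yes _ | no _ = colourA≢colourB {F y₁ % j₀} (m%n<n (R y₂) j₁)
  ... | no _ | yes _ = colourA≢colourB {F y₂ % j₀} (m%n<n (R y₁) j₁) ∘ sym

  colour-periodic : ∀ {n P Q} → (∀ y → F (y + n) ≡ F y + P) → n ≡ P + Q → j₀ ∣ P → j₁ ∣ Q →
    ∀ y → colour (y + n) ≡ colour y
  colour-periodic {n} {P} {Q} F-period n≡P+Q j₀∣P j₁∣Q y
    with F (suc (y + n)) ≟ suc (F (y + n)) | F (suc y) ≟ suc (F y)
  ... | yes _ | yes _ = cong colourA (trans (cong (_% j₀) (F-period y)) (%-remove-+ʳ (F y) j₀∣P))
  ... | no _  | no _  =
    cong colourB (trans (cong (_% j₁) (R-shift y (F-period y) n≡P+Q)) (%-remove-+ʳ (R y) j₁∣Q))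
  ... | yes shifted-step | no ¬step = contradiction (+-cancelʳ-≡ P _ _ (begin
      F (suc y) + P      ≡⟨ F-period (suc y) ⟨
      F (suc (y + n))    ≡⟨ shifted-step ⟩
      suc (F (y + n))    ≡⟨ cong suc (F-period y) ⟩
      suc (F y) + P      ∎)) ¬step
    where open ≡-Reasoning
  ... | no ¬shifted-step | yes step = contradiction (begin
      F (suc (y + n))    ≡⟨ F-period (suc y) ⟩
      F (suc y) + P      ≡⟨ cong (_+ P) step ⟩
      suc (F y) + P      ≡⟨ cong suc (F-period y) ⟨
      suc (F (y + n))    ∎) ¬shifted-step
    where open ≡-Reasoning

  count-colour-1 : ∀ a L s → F (a + L) ≡ F a + s * j₀ → count (λ y → colour y ≡ᵇ 1) a L ≡ s
  count-colour-1 a L s F-rise =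
    trans (Fs.count-along _ (divisible? j₀) on-step off-step a L (s * j₀) F-rise) (count-divisible j₀ (F a) s)
    where
    colourA≡ᵇ1 : ∀ x → (colourA x ≡ᵇ 1) ≡ (x ≡ᵇ 0)
    colourA≡ᵇ1 zero    = refl
    colourA≡ᵇ1 (suc x) = refl
    on-step : ∀ y → F (suc y) ≡ suc (F y) → (colour y ≡ᵇ 1) ≡ divisible? j₀ (F y)
    on-step y step with F (suc y) ≟ suc (F y)
    ... | yes _    = colourA≡ᵇ1 (F y % j₀)
    ... | no ¬step = contradiction step ¬step
    off-step : ∀ y → F (suc y) ≡ F y → (colour y ≡ᵇ 1) ≡ false
    off-step y stay with F (suc y) ≟ suc (F y)
    ... | yes step = contradiction (trans (sym step) stay) 1+n≢n
    ... | no _     = refl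

  count-colour-2 : ∀ a L t → R (a + L) ≡ R a + t * j₁ → count (λ y → colour y ≡ᵇ 2) a L ≡ t
  count-colour-2 a L t R-rise =
    trans (Rs.count-along _ (divisible? j₁) on-step off-step a L (t * j₁) R-rise) (count-divisible j₁ (R a) t)
    where
    colourA≢2 : ∀ x → (colourA x ≡ᵇ 2) ≡ false
    colourA≢2 zero    = refl
    colourA≢2 (suc x) = 1+n≢ᵇ0 j₁ x
      where
      1+n≢ᵇ0 : ∀ m n → .{{_ : NonZero m}} → (m + n ≡ᵇ 0) ≡ false
      1+n≢ᵇ0 (suc m) n = refl
    on-step : ∀ y → R (suc y) ≡ suc (R y) → (colour y ≡ᵇ 2) ≡ divisible? j₁ (R y)
    on-step y R-step with F (suc y) ≟ suc (F y)
    ... | yes step = contradiction (trans (sym R-step) (R-stay-on-step y step)) 1+n≢n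
    ... | no _     = refl
    off-step : ∀ y → R (suc y) ≡ R y → (colour y ≡ᵇ 2) ≡ false
    off-step y R-stay with F (suc y) ≟ suc (F y)
    ... | yes _    = colourA≢2 (F y % j₀)
    ... | no ¬step = contradiction (trans (sym (R-step-on-stay y (stay-of-¬step y ¬step))) R-stay) 1+n≢n

-- Vertices are grouped into blocks of d; block b receives G (b + q + 1) ∸ G (b + q) of the
-- vertices where F steps, with G b = ⌊b P / e⌋: α b of them at the start of its first r
-- positions and β b at the start of the remaining d ∸ r.  The choice of α makes every window of
-- q blocks followed by r vertices contain exactly j₀ steps.  The four hypotheses on P ensure
-- that the subtractions defining α and β do not truncate and that α ≤ r and β ≤ d ∸ r.
module BlockCounter (d q r e j₀ P : ℕ) .{{_ : NonZero d}} .{{_ : NonZero e}} (r≤d : r ≤ d)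
  (qP≤j₀e : q * P ≤ j₀ * e) ([j₀∸r]e≤qP : (j₀ ∸ r) * e ≤ q * P)
  (j₀e≤[1+q]P : j₀ * e ≤ suc q * P) ([1+q]P≤[j₀+d∸r]e : suc q * P ≤ (j₀ + (d ∸ r)) * e) where

  G : ℕ → ℕ
  G b = b * P / e

  G-+-≤ : ∀ t s c → s * P ≤ c * e → G (t + s) ≤ G t + c
  G-+-≤ t s c sP≤ce = begin
    (t + s) * P / e     ≡⟨ cong (_/ e) (*-distribʳ-+ P t s) ⟩
    (t * P + s * P) / e ≤⟨ /-monoˡ-≤ e (+-monoʳ-≤ (t * P) sP≤ce) ⟩
    (t * P + c * e) / e ≡⟨ [m+kn]/n≡m/n+k (t * P) c e ⟩
    G t + c             ∎
    where open ≤-Reasoning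

  G-+-≥ : ∀ t s c → c * e ≤ s * P → G t + c ≤ G (t + s)
  G-+-≥ t s c ce≤sP = begin
    G t + c             ≡⟨ [m+kn]/n≡m/n+k (t * P) c e ⟨
    (t * P + c * e) / e ≤⟨ /-monoˡ-≤ e (+-monoʳ-≤ (t * P) ce≤sP) ⟩
    (t * P + s * P) / e ≡⟨ cong (_/ e) (*-distribʳ-+ P t s) ⟨
    (t + s) * P / e     ∎
    where open ≤-Reasoning

  G-periodic : ∀ b → G (e + b) ≡ P + G b
  G-periodic b = begin
    (e + b) * P / e     ≡⟨ cong (_/ e) (*-distribʳ-+ P e b) ⟩
    (e * P + b * P) / e ≡⟨ cong (λ x → (x + b * P) / e) (*-comm e P) ⟩
    (P * e + b * P) / e ≡⟨ +-distrib-/-∣ˡ (b * P) (divides-refl P) ⟩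
    P * e / e + G b     ≡⟨ cong (_+ G b) (m*n/n≡m P e) ⟩
    P + G b             ∎
    where open ≡-Reasoning

  G-periodic-+ : ∀ b s → G (e + b + s) ≡ P + G (b + s)
  G-periodic-+ b s = trans (cong G (+-assoc e b s)) (G-periodic (b + s))

  α β : ℕ → ℕ
  α b = (G b + j₀) ∸ G (b + q)
  β b = G (b + suc q) ∸ (G b + j₀)

  G+α≡G+j₀ : ∀ b → G (b + q) + α b ≡ G b + j₀
  G+α≡G+j₀ b = m+[n∸m]≡n (G-+-≤ b q j₀ qP≤j₀e)

  G+α+β≡G : ∀ b → G (b + q) + α b + β b ≡ G (b + suc q)
  G+α+β≡G b = trans (cong (_+ β b) (G+α≡G+j₀ b)) (m+[n∸m]≡n (G-+-≥ b (suc q) j₀ j₀e≤[1+q]P))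

  α≤r : ∀ b → α b ≤ r
  α≤r b = m≤n+o⇒m∸n≤o (G b + j₀) (G (b + q)) (begin
    G b + j₀               ≤⟨ +-monoʳ-≤ (G b) (m≤n+m∸n j₀ r) ⟩
    G b + (r + (j₀ ∸ r))   ≡⟨ regroup (G b) r (j₀ ∸ r) ⟩
    G b + (j₀ ∸ r) + r     ≤⟨ +-monoˡ-≤ r (G-+-≥ b q (j₀ ∸ r) [j₀∸r]e≤qP) ⟩
    G (b + q) + r          ∎)
    where
    open ≤-Reasoning
    regroup : ∀ g r x → g + (r + x) ≡ g + x + r
    regroup = solve-∀

  β≤d∸r : ∀ b → β b ≤ d ∸ r
  β≤d∸r b = m≤n+o⇒m∸n≤o (G (b + suc q)) (G b + j₀) (begin
    G (b + suc q)          ≤⟨ G-+-≤ b (suc q) (j₀ + (d ∸ r)) [1+q]P≤[j₀+d∸r]e ⟩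
    G b + (j₀ + (d ∸ r))   ≡⟨ +-assoc (G b) j₀ (d ∸ r) ⟨
    G b + j₀ + (d ∸ r)     ∎)
    where open ≤-Reasoning

  α-periodic : ∀ b → α (e + b) ≡ α b
  α-periodic b = begin
    (G (e + b) + j₀) ∸ G (e + b + q)   ≡⟨ cong₂ (λ x y → x + j₀ ∸ y) (G-periodic b) (G-periodic-+ b q) ⟩
    (P + G b + j₀) ∸ (P + G (b + q))   ≡⟨ cong (_∸ (P + G (b + q))) (+-assoc P (G b) j₀) ⟩
    (P + (G b + j₀)) ∸ (P + G (b + q)) ≡⟨ [m+n]∸[m+o]≡n∸o P (G b + j₀) (G (b + q)) ⟩
    α b                                ∎
    where open ≡-Reasoning

  β-periodic : ∀ b → β (e + b) ≡ β b
  β-periodic b = begin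
    G (e + b + suc q) ∸ (G (e + b) + j₀)   ≡⟨ cong₂ (λ x y → x ∸ (y + j₀)) (G-periodic-+ b (suc q)) (G-periodic b) ⟩
    (P + G (b + suc q)) ∸ (P + G b + j₀)   ≡⟨ cong ((P + G (b + suc q)) ∸_) (+-assoc P (G b) j₀) ⟩
    (P + G (b + suc q)) ∸ (P + (G b + j₀)) ≡⟨ [m+n]∸[m+o]≡n∸o P (G (b + suc q)) (G b + j₀) ⟩
    β b                                    ∎
    where open ≡-Reasoning

  profile : ℕ → ℕ → ℕ
  profile b o = o ⊓ α b + (o ∸ r) ⊓ β b

  profile-steps : ∀ b → UnitSteps (profile b)
  profile-steps b o with o <? r
  ... | yes o<r rewrite m≤n⇒m∸n≡0 (<⇒≤ o<r) | m≤n⇒m∸n≡0 o<r = +-unitStepˡ 0 (⊓-unitStep o (α b))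
  ... | no o≮r
    rewrite m≥n⇒m⊓n≡n (≤-trans (α≤r b) (≮⇒≥ o≮r))
          | m≥n⇒m⊓n≡n (≤-trans (α≤r b) (≤-trans (≮⇒≥ o≮r) (n≤1+n o)))
          | +-∸-assoc 1 (≮⇒≥ o≮r) = +-unitStepʳ (α b) (⊓-unitStep (o ∸ r) (β b))

  profile-0 : ∀ b → profile b 0 ≡ 0
  profile-0 b = cong (_⊓ β b) (0∸n≡0 r)

  profile-r : ∀ b → profile b r ≡ α b
  profile-r b = trans (cong₂ _+_ (m≥n⇒m⊓n≡n (α≤r b)) (cong (_⊓ β b) (n∸n≡0 r))) (+-identityʳ (α b))

  profile-d : ∀ b → profile b d ≡ α b + β b
  profile-d b = cong₂ _+_ (m≥n⇒m⊓n≡n (≤-trans (α≤r b) r≤d)) (m≥n⇒m⊓n≡n (β≤d∸r b))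

  profile-periodic : ∀ b o → profile (e + b) o ≡ profile b o
  profile-periodic b o = cong₂ (λ a c → o ⊓ a + (o ∸ r) ⊓ c) (α-periodic b) (β-periodic b)

  F : ℕ → ℕ
  F y = G (y / d + q) + profile (y / d) (y % d)

  F-block : ∀ b o → o < d → F (o + b * d) ≡ G (b + q) + profile b o
  F-block b o o<d = cong₂ (λ b′ o′ → G (b′ + q) + profile b′ o′) quotient remainder
    where
    quotient : (o + b * d) / d ≡ b
    quotient = trans ([m+kn]/n≡m/n+k o b d) (cong (_+ b) (m<n⇒m/n≡0 o<d))
    remainder : (o + b * d) % d ≡ o
    remainder = trans ([m+kn]%n≡m%n o b d) (m<n⇒m%n≡m o<d)

  F-block-end : ∀ b → F (d + b * d) ≡ G (b + q) + profile b d
  F-block-end b = begin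
    F (0 + suc b * d)                 ≡⟨ F-block (suc b) 0 (>-nonZero⁻¹ d) ⟩
    G (suc b + q) + profile (suc b) 0 ≡⟨ cong₂ _+_ (cong G (sym (+-suc b q))) (profile-0 (suc b)) ⟩
    G (b + suc q) + 0                 ≡⟨ +-identityʳ _ ⟩
    G (b + suc q)                     ≡⟨ G+α+β≡G b ⟨
    G (b + q) + α b + β b             ≡⟨ +-assoc (G (b + q)) (α b) (β b) ⟩
    G (b + q) + (α b + β b)           ≡⟨ cong (G (b + q) +_) (profile-d b) ⟨
    G (b + q) + profile b d           ∎
    where open ≡-Reasoning

  F-block-≤ : ∀ b o → o ≤ d → F (o + b * d) ≡ G (b + q) + profile b o
  F-block-≤ b o o≤d with m≤n⇒m<n∨m≡n o≤d
  ... | inj₁ o<d  = F-block b o o<d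
  ... | inj₂ refl = F-block-end b

  F-steps : UnitSteps F
  F-steps y = subst (UnitStep (F y)) (sym F-suc) (+-unitStepʳ (G (b + q)) (profile-steps b o))
    where
    b o : ℕ
    b = y / d
    o = y % d
    F-suc : F (suc y) ≡ G (b + q) + profile b (suc o)
    F-suc = trans (cong (F ∘ suc) (m≡m%n+[m/n]*n y d)) (F-block-≤ b (suc o) (m%n<n y d))

  F-window : ∀ b → F (b * d + (q * d + r)) ≡ F (b * d) + j₀
  F-window b = begin
    F (b * d + (q * d + r))           ≡⟨ cong F (regroup b q d r) ⟩
    F (r + (b + q) * d)               ≡⟨ F-block-≤ (b + q) r r≤d ⟩
    G (b + q + q) + profile (b + q) r ≡⟨ cong (G (b + q + q) +_) (profile-r (b + q)) ⟩
    G (b + q + q) + α (b + q)         ≡⟨ G+α≡G+j₀ (b + q) ⟩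
    G (b + q) + j₀                    ≡⟨ cong (_+ j₀) (+-identityʳ (G (b + q))) ⟨
    G (b + q) + 0 + j₀                ≡⟨ cong (λ x → G (b + q) + x + j₀) (profile-0 b) ⟨
    G (b + q) + profile b 0 + j₀      ≡⟨ cong (_+ j₀) (F-block b 0 (>-nonZero⁻¹ d)) ⟨
    F (b * d) + j₀                    ∎
    where
    open ≡-Reasoning
    regroup : ∀ b q d r → b * d + (q * d + r) ≡ r + (b + q) * d
    regroup = solve-∀

  F-periodic : ∀ y → F (y + e * d) ≡ F y + P
  F-periodic y = begin
    F (y + e * d)                     ≡⟨ cong₂ (λ b′ o′ → G (b′ + q) + profile b′ o′) quotient remainder ⟩
    G (e + b + q) + profile (e + b) o ≡⟨ cong₂ _+_ (G-periodic-+ b q) (profile-periodic b o) ⟩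
    P + G (b + q) + profile b o       ≡⟨ +-assoc P (G (b + q)) (profile b o) ⟩
    P + F y                           ≡⟨ +-comm P (F y) ⟩
    F y + P                           ∎
    where
    open ≡-Reasoning
    b o : ℕ
    b = y / d
    o = y % d
    quotient : (y + e * d) / d ≡ e + b
    quotient = trans ([m+kn]/n≡m/n+k y e d) (+-comm b e)
    remainder : (y + e * d) % d ≡ o
    remainder = [m+kn]%n≡m%n y e d

modℕ≡% : ∀ x n .{{_ : NonZero n}} → modℕ x n ≡ x % n
modℕ≡% x (suc n) = refl

periodic-colouring-proper : ∀ k ℓ e (col : ℕ → ℕ) .{{_ : NonZero (e * (k ∸ ℓ))}} →
  (∀ y → col (y + e * (k ∸ ℓ)) ≡ col y) →
  (∀ y → 1 ≤ col y × col y ≤ k) →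
  (∀ i {j j′} → j < j′ → j′ < k → col (i * (k ∸ ℓ) + j) ≢ col (i * (k ∸ ℓ) + j′)) →
  ProperColouring (cycle k ℓ e) k (col ∘ toℕ)
periodic-colouring-proper k ℓ e col periodic range rainbow = range ∘ toℕ , proper
  where
  n : ℕ
  n = e * (k ∸ ℓ)
  periodic-* : ∀ t y → col (y + t * n) ≡ col y
  periodic-* zero    y = cong col (+-identityʳ y)
  periodic-* (suc t) y =
    trans (cong col (sym (+-assoc y n (t * n)))) (trans (periodic-* t (y + n)) (periodic y))
  on-edge : ∀ i j (v : Fin n) → toℕ v ≡ modℕ (i * (k ∸ ℓ) + j) n → col (toℕ v) ≡ col (i * (k ∸ ℓ) + j)
  on-edge i j v v≡ = begin
    col (toℕ v)                 ≡⟨ cong col (trans v≡ (modℕ≡% x n)) ⟩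
    col (x % n)                 ≡⟨ periodic-* (x / n) (x % n) ⟨
    col (x % n + (x / n) * n)   ≡⟨ cong col (m≡m%n+[m/n]*n x n) ⟨
    col x                       ∎
    where
    open ≡-Reasoning
    x : ℕ
    x = i * (k ∸ ℓ) + j
  proper : ∀ i → i < e → ∀ u v → u ≢ v → InEdge (cycle k ℓ e) i u → InEdge (cycle k ℓ e) i v →
    col (toℕ u) ≢ col (toℕ v)
  proper i _ u v u≢v (j , j<k , u≡) (j′ , j′<k , v≡) eq with <-cmp j j′
  ... | tri< j<j′ _ _ = rainbow i j<j′ j′<k (trans (sym (on-edge i j u u≡)) (trans eq (on-edge i j′ v v≡)))
  ... | tri≈ _ refl _ = u≢v (toℕ-injective (trans u≡ (sym v≡)))
  ... | tri> _ _ j′<j = rainbow i j′<j j<k (trans (sym (on-edge i j′ v v≡)) (trans (sym eq) (on-edge i j u u≡)))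

classSize-count : ∀ k ℓ e (col : ℕ → ℕ) c →
  classSize (cycle k ℓ e) (col ∘ toℕ) c ≡ count (λ y → col y ≡ᵇ c) 0 (e * (k ∸ ℓ))
classSize-count k ℓ e col c = length-filter-tabulate (e * (k ∸ ℓ)) 0 id (λ _ → sym (+-identityʳ _))
  where
  length-filter-tabulate : ∀ {N} n a (g : Fin n → Fin N) → (∀ i → toℕ (g i) ≡ toℕ i + a) →
    length (filter (λ v → col (toℕ v) ≟ c) (tabulate g)) ≡ count (λ y → col y ≡ᵇ c) a n
  length-filter-tabulate zero    a g g≡ = refl
  length-filter-tabulate (suc n) a g g≡ rewrite g≡ Fin.zero with col a ≡ᵇ c
  ... | true  = cong suc (length-filter-tabulate n (suc a) (g ∘ Fin.suc) (λ i → trans (g≡ (Fin.suc i)) (sym (+-suc (toℕ i) a))))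
  ... | false = length-filter-tabulate n (suc a) (g ∘ Fin.suc) (λ i → trans (g≡ (Fin.suc i)) (sym (+-suc (toℕ i) a)))

first-edge-vertex : ∀ {k n} → k ≤ n → Fin k → Fin n
first-edge-vertex k≤n j = fromℕ< (<-≤-trans (toℕ<n j) k≤n)

toℕ-first-edge-vertex : ∀ {k n} (k≤n : k ≤ n) j → toℕ (first-edge-vertex k≤n j) ≡ toℕ j
toℕ-first-edge-vertex k≤n j = toℕ-fromℕ< _

in-first-edge : ∀ k ℓ e .{{_ : NonZero (e * (k ∸ ℓ))}} (k≤n : k ≤ e * (k ∸ ℓ)) j →
  InEdge (cycle k ℓ e) 0 (first-edge-vertex k≤n j)
in-first-edge k ℓ e k≤n j = toℕ j , toℕ<n j , (begin
  toℕ (first-edge-vertex k≤n j) ≡⟨ toℕ-first-edge-vertex k≤n j ⟩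
  toℕ j                         ≡⟨ m<n⇒m%n≡m (<-≤-trans (toℕ<n j) k≤n) ⟨
  toℕ j % (e * (k ∸ ℓ))         ≡⟨ modℕ≡% (toℕ j) _ ⟨
  modℕ (toℕ j) (e * (k ∸ ℓ))    ∎)
  where open ≡-Reasoning

cycle-not-colourable : ∀ k ℓ e s .{{_ : NonZero (e * (k ∸ ℓ))}} → 0 < e → k ≤ e * (k ∸ ℓ) → s < k →
  ¬ Colourable (cycle k ℓ e) s
cycle-not-colourable k ℓ e s 0<e k≤n s<k (φ , range , proper)
  with pigeonhole s<k (λ j → fromℕ< (pred-colour<s (range (first-edge-vertex k≤n j))))
  where
  pred-colour<s : ∀ {x} → 1 ≤ x × x ≤ s → x ∸ 1 < s
  pred-colour<s (s≤s z≤n , x≤s) = x≤s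
... | i , j , i<j , same-colour =
  proper 0 0<e (vertex i) (vertex j) vertex-i≢j (in-first-edge k ℓ e k≤n i) (in-first-edge k ℓ e k≤n j)
    (∸-cancelʳ-≡ (proj₁ (range (vertex i))) (proj₁ (range (vertex j)))
      (trans (sym (toℕ-fromℕ< _)) (trans (cong toℕ same-colour) (toℕ-fromℕ< _))))
  where
  vertex : Fin k → Fin (e * (k ∸ ℓ))
  vertex = first-edge-vertex k≤n
  vertex-i≢j : vertex i ≢ vertex j
  vertex-i≢j eq = <⇒≢ i<j (trans (sym (toℕ-first-edge-vertex k≤n i))
                           (trans (cong toℕ eq) (toℕ-first-edge-vertex k≤n j)))

block-colouring : ∀ k ℓ e q r j₀ j₁ S T .{{_ : NonZero (k ∸ ℓ)}} .{{_ : NonZero e}}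
  .{{_ : NonZero j₀}} .{{_ : NonZero j₁}} → let d = k ∸ ℓ ; P = S * j₀ in
  r ≤ d → q * d + r ≡ k → j₀ + j₁ ≡ k → e * d ≡ P + T * j₁ →
  q * P ≤ j₀ * e → (j₀ ∸ r) * e ≤ q * P → j₀ * e ≤ suc q * P → suc q * P ≤ (j₀ + (d ∸ r)) * e →
  ∃ λ φ → ProperColouring (cycle k ℓ e) k φ ×
          classSize (cycle k ℓ e) φ 1 ≡ S × classSize (cycle k ℓ e) φ 2 ≡ T
block-colouring k ℓ e q r j₀ j₁ S T r≤d qd+r≡k j₀+j₁≡k n≡P+Tj₁ C₁ C₂ C₃ C₄ =
  colour ∘ toℕ , periodic-colouring-proper k ℓ e colour periodic range rainbow , size-1 , size-2
  where
  d : ℕ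
  d = k ∸ ℓ
  open BlockCounter d q r e j₀ (S * j₀) r≤d C₁ C₂ C₃ C₄
  open TwoCounterColouring F-steps j₀ j₁
  instance
    n≢0 : NonZero (e * d)
    n≢0 = m*n≢0 e d
  periodic : ∀ y → colour (y + e * d) ≡ colour y
  periodic = colour-periodic F-periodic n≡P+Tj₁ (divides S refl) (divides T refl)
  range : ∀ y → 1 ≤ colour y × colour y ≤ k
  range y with colour-range y
  ... | 1≤ , ≤j₀+j₁ = 1≤ , subst (colour y ≤_) j₀+j₁≡k ≤j₀+j₁
  rainbow : ∀ i {j j′} → j < j′ → j′ < k → colour (i * d + j) ≢ colour (i * d + j′)
  rainbow i j<j′ j′<k = colour-window-injective window (m≤m+n (i * d) _) (+-monoʳ-< (i * d) j<j′)
    (+-monoʳ-< (i * d) (subst (_ <_) (sym j₀+j₁≡k) j′<k))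
    where
    window : F (i * d + (j₀ + j₁)) ≡ F (i * d) + j₀
    window = trans (cong (λ x → F (i * d + x)) (trans j₀+j₁≡k (sym qd+r≡k))) (F-window i)
  size-1 : classSize (cycle k ℓ e) (colour ∘ toℕ) 1 ≡ S
  size-1 = trans (classSize-count k ℓ e colour 1) (count-colour-1 0 (e * d) S (F-periodic 0))
  size-2 : classSize (cycle k ℓ e) (colour ∘ toℕ) 2 ≡ T
  size-2 = trans (classSize-count k ℓ e colour 2) (count-colour-2 0 (e * d) T (R-shift 0 (F-periodic 0) n≡P+Tj₁))

density-colouring : ∀ k ℓ e q r j₀ j₁ S T .{{_ : NonZero (k ∸ ℓ)}} .{{_ : NonZero e}}
  .{{_ : NonZero j₀}} .{{_ : NonZero j₁}} → let d = k ∸ ℓ in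
  r ≤ d → q * d + r ≡ k → j₀ + j₁ ≡ k → j₀ ≤ d ∸ r → e * d ≡ S * j₀ + T * j₁ →
  q * S ≤ e → e ≤ suc q * S → suc q * S ≤ 2 * e → (j₀ ∸ r) * e ≤ q * (S * j₀) →
  ∃ λ φ → ProperColouring (cycle k ℓ e) k φ ×
          classSize (cycle k ℓ e) φ 1 ≡ S × classSize (cycle k ℓ e) φ 2 ≡ T
density-colouring k ℓ e q r j₀ j₁ S T r≤d qd+r≡k j₀+j₁≡k j₀≤d∸r n≡ qS≤e e≤[1+q]S [1+q]S≤2e C₂ =
  block-colouring k ℓ e q r j₀ j₁ S T r≤d qd+r≡k j₀+j₁≡k n≡ C₁ C₂ C₃ C₄
  where
  open ≤-Reasoning
  d : ℕ
  d = k ∸ ℓ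
  C₁ : q * (S * j₀) ≤ j₀ * e
  C₁ = begin
    q * (S * j₀) ≡⟨ *-assoc q S j₀ ⟨
    q * S * j₀   ≤⟨ *-monoˡ-≤ j₀ qS≤e ⟩
    e * j₀       ≡⟨ *-comm e j₀ ⟩
    j₀ * e       ∎
  C₃ : j₀ * e ≤ suc q * (S * j₀)
  C₃ = begin
    j₀ * e           ≡⟨ *-comm j₀ e ⟩
    e * j₀           ≤⟨ *-monoˡ-≤ j₀ e≤[1+q]S ⟩
    suc q * S * j₀   ≡⟨ *-assoc (suc q) S j₀ ⟩
    suc q * (S * j₀) ∎
  C₄ : suc q * (S * j₀) ≤ (j₀ + (d ∸ r)) * e
  C₄ = begin
    suc q * (S * j₀)    ≡⟨ *-assoc (suc q) S j₀ ⟨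
    suc q * S * j₀      ≤⟨ *-monoˡ-≤ j₀ [1+q]S≤2e ⟩
    2 * e * j₀          ≡⟨ regroup e j₀ ⟩
    (j₀ + j₀) * e       ≤⟨ *-monoˡ-≤ e (+-monoʳ-≤ j₀ j₀≤d∸r) ⟩
    (j₀ + (d ∸ r)) * e  ∎
    where
    regroup : ∀ e j → 2 * e * j ≡ (j + j) * e
    regroup = solve-∀

one-apart⇒gcd≡1 : ∀ k ℓ e .{{_ : NonZero (e * (k ∸ ℓ))}} → 0 < e → k ≤ e * (k ∸ ℓ) → ∀ {S T} →
  ∣ S - T ∣ ≡ 1 →
  (∃ λ φ → ProperColouring (cycle k ℓ e) k φ ×
           classSize (cycle k ℓ e) φ 1 ≡ S × classSize (cycle k ℓ e) φ 2 ≡ T) →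
  IsGcdD (cycle k ℓ e) 1
one-apart⇒gcd≡1 k ℓ e 0<e k≤n ∣S-T∣≡1 (φ , proper , size-1 , size-2) =
  (λ x _ _ → 1∣ x) , (λ d d∣D → d∣D 1 1∈D λ ())
  where
  χ≡k : IsChromaticNumber (cycle k ℓ e) k
  χ≡k = (φ , proper) , λ s → cycle-not-colourable k ℓ e s 0<e k≤n
  1∈D : InD (cycle k ℓ e) 1
  1∈D = k , χ≡k , φ , proper , sym (trans (cong₂ ∣_-_∣ size-1 size-2) ∣S-T∣≡1)

ceilDiv[qd+r]≡1+q : ∀ q d r → 0 < r → r ≤ d → ceilDiv (q * d + r) d ≡ suc q
ceilDiv[qd+r]≡1+q q (suc d′) (suc r′) _ (s≤s r′≤d′) = begin
  (q * suc d′ + suc r′ + d′) / suc d′ ≡⟨ cong (_/ suc d′) (regroup q d′ r′) ⟩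
  (r′ + suc q * suc d′) / suc d′      ≡⟨ [m+kn]/n≡m/n+k r′ (suc q) (suc d′) ⟩
  r′ / suc d′ + suc q                 ≡⟨ cong (_+ suc q) (m<n⇒m/n≡0 (s≤s r′≤d′)) ⟩
  suc q                               ∎
  where
  open ≡-Reasoning
  regroup : ∀ q d′ r′ → q * suc d′ + suc r′ + d′ ≡ r′ + suc q * suc d′
  regroup = solve-∀

ℓ+d≡qd+r⇒q≤ℓ : ∀ {q d r ℓ} .{{_ : NonZero d}} → 0 < r → ℓ + d ≡ q * d + r → q ≤ ℓ
ℓ+d≡qd+r⇒q≤ℓ {zero}          _   _        = z≤n
ℓ+d≡qd+r⇒q≤ℓ {suc c} {d} {r} {ℓ} 0<r ℓ+d≡ = begin
  suc c      ≡⟨ +-comm 1 c ⟩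
  c + 1      ≤⟨ +-mono-≤ (m≤m*n c d) 0<r ⟩
  c * d + r  ≡⟨ +-cancelˡ-≡ d _ _ (trans (regroup d c r) (trans (sym ℓ+d≡) (+-comm ℓ d))) ⟩
  ℓ          ∎
  where
  open ≤-Reasoning
  regroup : ∀ d c r → d + (c * d + r) ≡ suc c * d + r
  regroup = solve-∀

module QuotientRemainder (k ℓ q r : ℕ) (ℓ≤k : ℓ ≤ k) (0<r : 0 < r) (r<d : r < k ∸ ℓ)
  (qd+r≡k : q * (k ∸ ℓ) + r ≡ k) where

  d M : ℕ
  d = k ∸ ℓ
  M = k * ℓ * d

  instance
    d≢0 : NonZero d
    d≢0 = >-nonZero (<-trans 0<r r<d)
    k≢0 : NonZero k
    k≢0 = >-nonZero (<-≤-trans (<-trans 0<r r<d) (m∸n≤m k ℓ))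
    r≢0 : NonZero r
    r≢0 = >-nonZero 0<r

  ℓ+d≡k : ℓ + d ≡ k
  ℓ+d≡k = m+[n∸m]≡n ℓ≤k

  qd≤k : q * d ≤ k
  qd≤k = subst (q * d ≤_) qd+r≡k (m≤m+n (q * d) r)

  k≤[1+q]d : k ≤ suc q * d
  k≤[1+q]d = begin
    k         ≡⟨ qd+r≡k ⟨
    q * d + r ≤⟨ +-monoʳ-≤ (q * d) (<⇒≤ r<d) ⟩
    q * d + d ≡⟨ +-comm (q * d) d ⟩
    suc q * d ∎
    where open ≤-Reasoning

  instance
    q≢0 : NonZero q
    q≢0 = ≢-nonZero λ q≡0 → <⇒≱ (<-≤-trans r<d (m∸n≤m k ℓ)) (begin
      k         ≡⟨ qd+r≡k ⟨
      q * d + r ≡⟨ cong (λ x → x * d + r) q≡0 ⟩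
      r         ∎)
      where open ≤-Reasoning

  q≤ℓ : q ≤ ℓ
  q≤ℓ = ℓ+d≡qd+r⇒q≤ℓ {q} {d} 0<r (trans ℓ+d≡k (sym qd+r≡k))

  qk≤r[kℓ] : q * k ≤ r * (k * ℓ)
  qk≤r[kℓ] = begin
    q * k       ≤⟨ *-monoˡ-≤ k q≤ℓ ⟩
    ℓ * k       ≡⟨ *-comm ℓ k ⟩
    k * ℓ       ≤⟨ m≤n*m (k * ℓ) r ⟩
    r * (k * ℓ) ∎
    where open ≤-Reasoning

  kkℓ≡qM+r[kℓ] : k * k * ℓ ≡ q * M + r * (k * ℓ)
  kkℓ≡qM+r[kℓ] = begin
    k * k * ℓ               ≡⟨ *-assoc k k ℓ ⟩
    k * (k * ℓ)             ≡⟨ cong (_* (k * ℓ)) qd+r≡k ⟨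
    (q * d + r) * (k * ℓ)   ≡⟨ expand q d r (k * ℓ) ⟩
    q * M + r * (k * ℓ)     ∎
    where
    open ≡-Reasoning
    expand : ∀ q d r K → (q * d + r) * K ≡ q * (K * d) + r * K
    expand = solve-∀

  kkℓ≤[1+q]M : k * k * ℓ ≤ suc q * M
  kkℓ≤[1+q]M = begin
    k * k * ℓ           ≡⟨ *-assoc k k ℓ ⟩
    k * (k * ℓ)         ≤⟨ *-monoˡ-≤ (k * ℓ) k≤[1+q]d ⟩
    suc q * d * (k * ℓ) ≡⟨ regroup (suc q) d (k * ℓ) ⟩
    suc q * M           ∎
    where
    open ≤-Reasoning
    regroup : ∀ a d K → a * d * K ≡ a * (K * d)
    regroup = solve-∀

  [1+q]M≤2kkℓ : suc q * M ≤ 2 * (k * k * ℓ)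
  [1+q]M≤2kkℓ = begin
    suc q * M             ≡⟨ regroup (suc q) d (k * ℓ) ⟨
    (d + q * d) * (k * ℓ) ≤⟨ *-monoˡ-≤ (k * ℓ) (+-mono-≤ (m∸n≤m k ℓ) qd≤k) ⟩
    (k + k) * (k * ℓ)     ≡⟨ double k ℓ ⟩
    2 * (k * k * ℓ)       ∎
    where
    open ≤-Reasoning
    regroup : ∀ a d K → a * d * K ≡ a * (K * d)
    regroup = solve-∀
    double : ∀ k ℓ → (k + k) * (k * ℓ) ≡ 2 * (k * k * ℓ)
    double = solve-∀

  [kkℓ+x]d≡kM+xd : ∀ x → (k * k * ℓ + x) * d ≡ k * M + x * d
  [kkℓ+x]d≡kM+xd x = expand k ℓ d x
    where
    expand : ∀ k ℓ d x → (k * k * ℓ + x) * d ≡ k * (k * ℓ * d) + x * d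
    expand = solve-∀

  instance
    ℓ≢0 : NonZero ℓ
    ℓ≢0 = >-nonZero (<-≤-trans (>-nonZero⁻¹ q) q≤ℓ)
    kkℓ≢0 : NonZero (k * k * ℓ)
    kkℓ≢0 = m*n≢0 (k * k) ℓ {{m*n≢0 k k}}

  module OneMarkedPerEdge (m : ℕ) where

    e u ρ S T : ℕ
    e = k * k * ℓ + m
    u = m * d / k
    ρ = m * d % k
    S = M + u + ρ
    T = M + u

    instance
      e≢0 : NonZero e
      e≢0 = >-nonZero (<-≤-trans (>-nonZero⁻¹ (k * k * ℓ)) (m≤m+n (k * k * ℓ) m))
      k-1≢0 : NonZero (pred k)
      k-1≢0 = >-nonZero (<⇒≤pred (<-≤-trans (≤-<-trans 0<r r<d) (m∸n≤m k ℓ)))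

    qu≤m : q * u ≤ m
    qu≤m = *-cancelʳ-≤ (q * u) m k (begin
      q * u * k   ≡⟨ *-assoc q u k ⟩
      q * (u * k) ≤⟨ *-monoʳ-≤ q (m/n*n≤m (m * d) k) ⟩
      q * (m * d) ≡⟨ swap q m d ⟩
      m * (q * d) ≤⟨ *-monoʳ-≤ m qd≤k ⟩
      m * k       ∎)
      where
      open ≤-Reasoning
      swap : ∀ q m d → q * (m * d) ≡ m * (q * d)
      swap = solve-∀

    qS≤e : q * S ≤ e
    qS≤e = begin
      q * (M + u + ρ)           ≡⟨ expand q M u ρ ⟩
      q * M + q * u + q * ρ     ≤⟨ +-mono-≤ (+-monoʳ-≤ (q * M) qu≤m) (≤-trans (*-monoʳ-≤ q (<⇒≤ (m%n<n (m * d) k))) qk≤r[kℓ]) ⟩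
      q * M + m + r * (k * ℓ)   ≡⟨ +-assoc (q * M) m (r * (k * ℓ)) ⟩
      q * M + (m + r * (k * ℓ)) ≡⟨ cong (q * M +_) (+-comm m (r * (k * ℓ))) ⟩
      q * M + (r * (k * ℓ) + m) ≡⟨ +-assoc (q * M) (r * (k * ℓ)) m ⟨
      q * M + r * (k * ℓ) + m   ≡⟨ cong (_+ m) kkℓ≡qM+r[kℓ] ⟨
      e                         ∎
      where
      open ≤-Reasoning
      expand : ∀ q M u ρ → q * (M + u + ρ) ≡ q * M + q * u + q * ρ
      expand = solve-∀

    m≤[1+q][u+ρ] : m ≤ suc q * (u + ρ)
    m≤[1+q][u+ρ] = *-cancelˡ-≤ k (begin
      k * m                   ≤⟨ *-monoˡ-≤ m k≤[1+q]d ⟩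
      suc q * d * m           ≡⟨ regroup (suc q) d m ⟩
      suc q * (m * d)         ≡⟨ cong (suc q *_) (m≡m%n+[m/n]*n (m * d) k) ⟩
      suc q * (ρ + u * k)     ≤⟨ *-monoʳ-≤ (suc q) (+-monoˡ-≤ (u * k) (m≤m*n ρ k)) ⟩
      suc q * (ρ * k + u * k) ≡⟨ collect (suc q) ρ u k ⟩
      k * (suc q * (u + ρ))   ∎)
      where
      open ≤-Reasoning
      regroup : ∀ a d m → a * d * m ≡ a * (m * d)
      regroup = solve-∀
      collect : ∀ a ρ u k → a * (ρ * k + u * k) ≡ k * (a * (u + ρ))
      collect = solve-∀

    e≤[1+q]S : e ≤ suc q * S
    e≤[1+q]S = begin
      k * k * ℓ + m               ≤⟨ +-mono-≤ kkℓ≤[1+q]M m≤[1+q][u+ρ] ⟩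
      suc q * M + suc q * (u + ρ) ≡⟨ collect (suc q) M u ρ ⟩
      suc q * (M + u + ρ)         ∎
      where
      open ≤-Reasoning
      collect : ∀ a M u ρ → a * M + a * (u + ρ) ≡ a * (M + u + ρ)
      collect = solve-∀

    [1+q]S≤2e : suc q * S ≤ 2 * e
    [1+q]S≤2e = begin
      S + q * S   ≤⟨ +-mono-≤ (≤-trans (m≤n*m S q) qS≤e) qS≤e ⟩
      e + e       ≡⟨ cong (e +_) (+-identityʳ e) ⟨
      2 * e       ∎
      where open ≤-Reasoning

    [1∸r]e≤qS : (1 ∸ r) * e ≤ q * (S * 1)
    [1∸r]e≤qS = subst (λ x → x * e ≤ q * (S * 1)) (sym (m≤n⇒m∸n≡0 0<r)) z≤n

    n≡S+T[k-1] : e * d ≡ S * 1 + T * pred k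
    n≡S+T[k-1] = begin
      (k * k * ℓ + m) * d ≡⟨ [kkℓ+x]d≡kM+xd m ⟩
      k * M + m * d       ≡⟨ cong (k * M +_) (m≡m%n+[m/n]*n (m * d) k) ⟩
      k * M + (ρ + u * k) ≡⟨ subst (λ x → x * M + (ρ + u * x) ≡ S * 1 + T * pred k) (suc-pred k) (split (pred k) M u ρ) ⟩
      S * 1 + T * pred k  ∎
      where
      open ≡-Reasoning
      split : ∀ k′ M u ρ → suc k′ * M + (ρ + u * suc k′) ≡ (M + u + ρ) * 1 + (M + u) * k′
      split = solve-∀

    colouring : ∃ λ φ → ProperColouring (cycle k ℓ e) k φ ×
                        classSize (cycle k ℓ e) φ 1 ≡ S × classSize (cycle k ℓ e) φ 2 ≡ T
    colouring = density-colouring k ℓ e q r 1 (pred k) S T (<⇒≤ r<d) qd+r≡k (suc-pred k)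
      (m<n⇒0<n∸m r<d) n≡S+T[k-1] qS≤e e≤[1+q]S [1+q]S≤2e [1∸r]e≤qS

  partite : ∀ m → Partite k (cycle k ℓ (k * k * ℓ + m))
  partite m = let φ , proper , _ = OneMarkedPerEdge.colouring m in φ , proper

  module OneApart where

    e S T j₀ j₁ : ℕ
    e = k * k * ℓ + suc q
    S = M + 2
    T = M + 1
    j₀ = d ∸ r
    j₁ = ℓ + r

    instance
      e≢0 : NonZero e
      e≢0 = >-nonZero (<-≤-trans (s≤s z≤n) (m≤n+m (suc q) (k * k * ℓ)))
      j₀≢0 : NonZero j₀
      j₀≢0 = >-nonZero (m<n⇒0<n∸m r<d)
      j₁≢0 : NonZero j₁
      j₁≢0 = >-nonZero (<-≤-trans 0<r (m≤n+m r ℓ))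

    j₀+j₁≡k : j₀ + j₁ ≡ k
    j₀+j₁≡k = begin
      (d ∸ r) + (ℓ + r) ≡⟨ swap (d ∸ r) ℓ r ⟩
      ℓ + (d ∸ r + r)   ≡⟨ cong (ℓ +_) (m∸n+n≡m (<⇒≤ r<d)) ⟩
      ℓ + d             ≡⟨ ℓ+d≡k ⟩
      k                 ∎
      where
      open ≡-Reasoning
      swap : ∀ a b c → a + (b + c) ≡ b + (a + c)
      swap = solve-∀

    [1+q]d≡j₀+k : suc q * d ≡ j₀ + k
    [1+q]d≡j₀+k = begin
      d + q * d        ≡⟨ cong (_+ q * d) (m∸n+n≡m (<⇒≤ r<d)) ⟨
      j₀ + r + q * d   ≡⟨ +-assoc j₀ r (q * d) ⟩
      j₀ + (r + q * d) ≡⟨ cong (j₀ +_) (trans (+-comm r (q * d)) qd+r≡k) ⟩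
      j₀ + k           ∎
      where open ≡-Reasoning

    n≡Sj₀+Tj₁ : e * d ≡ S * j₀ + T * j₁
    n≡Sj₀+Tj₁ = begin
      (k * k * ℓ + suc q) * d             ≡⟨ [kkℓ+x]d≡kM+xd (suc q) ⟩
      k * M + suc q * d                   ≡⟨ cong (k * M +_) [1+q]d≡j₀+k ⟩
      k * M + (j₀ + k)                    ≡⟨ cong (λ y → y * M + (j₀ + y)) j₀+j₁≡k ⟨
      (j₀ + j₁) * M + (j₀ + (j₀ + j₁))    ≡⟨ split M j₀ j₁ ⟩
      (M + 2) * j₀ + (M + 1) * j₁         ∎
      where
      open ≡-Reasoning
      split : ∀ M a b → (a + b) * M + (a + (a + b)) ≡ (M + 2) * a + (M + 1) * b
      split = solve-∀

    qS≤e : q * S ≤ e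
    qS≤e = begin
      q * (M + 2)                   ≡⟨ expand q M ⟩
      q * M + (q + q)               ≤⟨ +-monoʳ-≤ (q * M) (+-mono-≤ (≤-trans (m≤m*n q k) qk≤r[kℓ]) (n≤1+n q)) ⟩
      q * M + (r * (k * ℓ) + suc q) ≡⟨ +-assoc (q * M) (r * (k * ℓ)) (suc q) ⟨
      q * M + r * (k * ℓ) + suc q   ≡⟨ cong (_+ suc q) kkℓ≡qM+r[kℓ] ⟨
      e                             ∎
      where
      open ≤-Reasoning
      expand : ∀ q M → q * (M + 2) ≡ q * M + (q + q)
      expand = solve-∀

    e≤[1+q]S : e ≤ suc q * S
    e≤[1+q]S = begin
      k * k * ℓ + suc q         ≤⟨ +-mono-≤ kkℓ≤[1+q]M (m≤m*n (suc q) 2) ⟩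
      suc q * M + suc q * 2     ≡⟨ *-distribˡ-+ (suc q) M 2 ⟨
      suc q * (M + 2)           ∎
      where open ≤-Reasoning

    [1+q]S≤2e : suc q * S ≤ 2 * e
    [1+q]S≤2e = begin
      suc q * (M + 2)             ≡⟨ *-distribˡ-+ (suc q) M 2 ⟩
      suc q * M + suc q * 2       ≤⟨ +-mono-≤ [1+q]M≤2kkℓ (≤-reflexive (*-comm (suc q) 2)) ⟩
      2 * (k * k * ℓ) + 2 * suc q ≡⟨ *-distribˡ-+ 2 (k * k * ℓ) (suc q) ⟨
      2 * e                       ∎
      where open ≤-Reasoning

    -- With j₀ = x + r, each of the three summands of x * e is bounded by a summand of q * S * j₀.
    [j₀∸r]e≤qSj₀ : (j₀ ∸ r) * e ≤ q * (S * j₀)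
    [j₀∸r]e≤qSj₀ with r ≤? j₀
    ... | no r≰j₀ = subst (λ x → x * e ≤ q * (S * j₀)) (sym (m≤n⇒m∸n≡0 (<⇒≤ (≰⇒> r≰j₀)))) z≤n
    ... | yes r≤j₀ = begin
      x * e                                                  ≡⟨ cong (λ y → x * (y + suc q)) kkℓ≡qM+r[kℓ] ⟩
      x * (q * M + r * (k * ℓ) + suc q)                      ≡⟨ expand x q M r (k * ℓ) ⟩
      q * (M * x) + x * (r * (k * ℓ)) + x * suc q            ≤⟨ +-mono-≤ (+-monoʳ-≤ (q * (M * x)) x[r[kℓ]]≤q[Mr]) x[1+q]≤q[2x] ⟩
      q * (M * x) + q * (M * r) + q * (2 * x)                ≤⟨ m≤m+n _ (q * (2 * r)) ⟩
      q * (M * x) + q * (M * r) + q * (2 * x) + q * (2 * r)  ≡⟨ collect q M x r ⟩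
      q * ((M + 2) * (x + r))                                ≡⟨ cong (λ y → q * (S * y)) (m∸n+n≡m r≤j₀) ⟩
      q * (S * j₀)                                           ∎
      where
      open ≤-Reasoning
      x : ℕ
      x = j₀ ∸ r
      x[r[kℓ]]≤q[Mr] : x * (r * (k * ℓ)) ≤ q * (M * r)
      x[r[kℓ]]≤q[Mr] = begin
        x * (r * (k * ℓ)) ≤⟨ *-monoˡ-≤ (r * (k * ℓ)) (≤-trans (m∸n≤m j₀ r) (m∸n≤m d r)) ⟩
        d * (r * (k * ℓ)) ≡⟨ regroup d r (k * ℓ) ⟩
        M * r             ≤⟨ m≤n*m (M * r) q ⟩
        q * (M * r)       ∎
        where
        regroup : ∀ d r K → d * (r * K) ≡ K * d * r
        regroup = solve-∀
      x[1+q]≤q[2x] : x * suc q ≤ q * (2 * x)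
      x[1+q]≤q[2x] = begin
        x * suc q    ≡⟨ *-suc x q ⟩
        x + x * q    ≤⟨ +-mono-≤ (m≤n*m x q) (≤-reflexive (*-comm x q)) ⟩
        q * x + q * x ≡⟨ double q x ⟩
        q * (2 * x)  ∎
        where
        double : ∀ q x → q * x + q * x ≡ q * (2 * x)
        double = solve-∀
      expand : ∀ x q M r K → x * (q * M + r * K + suc q) ≡ q * (M * x) + x * (r * K) + x * suc q
      expand = solve-∀
      collect : ∀ q M x r → q * (M * x) + q * (M * r) + q * (2 * x) + q * (2 * r) ≡ q * ((M + 2) * (x + r))
      collect = solve-∀

    colouring : ∃ λ φ → ProperColouring (cycle k ℓ e) k φ ×
                        classSize (cycle k ℓ e) φ 1 ≡ S × classSize (cycle k ℓ e) φ 2 ≡ T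
    colouring = density-colouring k ℓ e q r j₀ j₁ S T (<⇒≤ r<d) qd+r≡k j₀+j₁≡k ≤-refl
      n≡Sj₀+Tj₁ qS≤e e≤[1+q]S [1+q]S≤2e [j₀∸r]e≤qSj₀

  gcd-one : IsGcdD (cycle k ℓ (k * k * ℓ + suc q)) 1
  gcd-one = one-apart⇒gcd≡1 k ℓ e (>-nonZero⁻¹ e) k≤n (∣m+n-m+o∣≡∣n-o∣ M 2 1) colouring
    where
    open OneApart using (e; e≢0; colouring)
    instance
      n≢0 : NonZero (e * d)
      n≢0 = m*n≢0 e d
    k≤n : k ≤ e * d
    k≤n = begin
      k              ≤⟨ m≤m*n k (k * ℓ) {{m*n≢0 k ℓ}} ⟩
      k * (k * ℓ)    ≡⟨ *-assoc k k ℓ ⟨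
      k * k * ℓ      ≤⟨ m≤m+n (k * k * ℓ) (suc q) ⟩
      e              ≤⟨ m≤m*n e d ⟩
      e * d          ∎
      where open ≤-Reasoning

≤∸1⇒< : ∀ {ℓ k} → 1 ≤ ℓ → ℓ ≤ k ∸ 1 → ℓ < k
≤∸1⇒< {k = suc k} _ ℓ≤k = s≤s ℓ≤k
≤∸1⇒< {suc ℓ} {zero} _ ()

lemma5p3 : (k ℓ m : ℕ) → 1 ≤ ℓ → ℓ ≤ k ∸ 1 → ¬ ((k ∸ ℓ) ∣ k) →
    ceilDiv k (k ∸ ℓ) ≤ m →
    Partite k (cycle k ℓ (k * k * ℓ + m)) ×
    (m ≡ ceilDiv k (k ∸ ℓ) → IsGcdD (cycle k ℓ (k * k * ℓ + m)) 1)
-- k-partiteness holds for every m.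
lemma5p3 k ℓ m 1≤ℓ ℓ≤k∸1 d∤k _ = partite m , λ m≡⌈k/d⌉ →
  subst (λ x → IsGcdD (cycle k ℓ (k * k * ℓ + x)) 1) (sym (trans m≡⌈k/d⌉ ⌈k/d⌉≡1+q)) gcd-one
  where
  ℓ<k : ℓ < k
  ℓ<k = ≤∸1⇒< 1≤ℓ ℓ≤k∸1
  d : ℕ
  d = k ∸ ℓ
  instance
    d≢0 : NonZero d
    d≢0 = >-nonZero (m<n⇒0<n∸m ℓ<k)
  q r : ℕ
  q = k / d
  r = k % d
  0<r : 0 < r
  0<r = n≢0⇒n>0 (d∤k ∘ m%n≡0⇒n∣m k d)
  qd+r≡k : q * d + r ≡ k
  qd+r≡k = sym (trans (m≡m%n+[m/n]*n k d) (+-comm r (q * d)))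
  open QuotientRemainder k ℓ q r (<⇒≤ ℓ<k) 0<r (m%n<n k d) qd+r≡k using (partite; gcd-one)
  ⌈k/d⌉≡1+q : ceilDiv k d ≡ suc q
  ⌈k/d⌉≡1+q = subst (λ x → ceilDiv x d ≡ suc q) qd+r≡k (ceilDiv[qd+r]≡1+q q d r 0<r (<⇒≤ (m%n<n k d)))
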